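{- Let $S=\{x_1 < x_2 < \cdots < x_p\}$ be an admissible pinnacle set and let $\mathcal{A}$ be an ordering of $S$. Then $\mathcal{A}$ is admissible if and only if, for each $i$ with $1<i<p$ such that both (i) $x_i<\min\{p+i+1,3i\}$ and (ii) $x_{i-1}+2\geq x_i$ and $x_i\leq x_{i+1}-2$ hold, the set $S_{x_i}$ is interrupted at most $k_{x_i}=|\overline{S}_{x_i}| - |S_{x_i}|-1$ times in $\mathcal{A}$.
   Context: A permutation $w = w(1)\cdots w(n)$ of $[n]$ has a pinnacle $w(i)$ whenever $i\in[2,n-1]$ and $w(i-1) < w(i) > w(i+1)$. A set $S$ of positive integers is an admissible pinnacle set if some permutation has pinnacle set exactly $S$. An ordering of $S$ is admissible if there is a permutation with pinnacle set $S$ whose pinnacles appear left to right in that order. For a positive integer $x$, $S_x := [1,x]\cap S$ and $\overline{S}_x := [1,x]\setminus S$. For $T\subseteq S$ and an ordering $\mathcal{A}$ of $S$, write $\mathcal{A}$ as a word $a_0 t_1 a_1 \cdots a_{k-1} t_k a_k$ with each $t_i$ a nonempty word of elements of $T$, each $a_i$ a word of elements of $S\setminus T$, and only $a_0,a_k$ possibly empty; then $T$ is interrupted $k-1$ times in $\mathcal{A}$. -}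

module Defs where

open import Data.Nat using (ℕ; zero; suc; _+_; _*_; _∸_; _≤_; _<_; _<ᵇ_; _≤ᵇ_)
open import Data.Nat.Properties using (_≟_)
open import Data.Bool using (Bool; true; false; if_then_else_; _∧_; not)
open import Data.List using (List; []; _∷_; _++_; map; upTo; length; filter)
open import Data.List.Membership.DecPropositional _≟_ using (_∈?_)
open import Data.List.Relation.Binary.Permutation.Propositional using (_↭_)
open import Data.Product using (Σ; ∃; _×_)
open import Relation.Binary.PropositionalEquality using (_≡_)
open import Relation.Nullary.Decidable using (⌊_⌋; ¬?)
open import Data.Integer as ℤ using (ℤ; +_)

interval : ℕ → List ℕ
interval n = map suc (upTo n)

IsPerm : ℕ → List ℕ → Set
IsPerm n w = w ↭ interval n

pinnacles : List ℕ → List ℕ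
pinnacles (a ∷ b ∷ c ∷ rest) =
  (if (a <ᵇ b) ∧ (c <ᵇ b) then b ∷ [] else []) ++ pinnacles (b ∷ c ∷ rest)
pinnacles _ = []

AdmissibleSet : List ℕ → Set
AdmissibleSet S = ∃ λ n → ∃ λ w → IsPerm n w × (pinnacles w ↭ S)

AdmissibleOrdering : List ℕ → Set
AdmissibleOrdering 𝒜 = ∃ λ n → ∃ λ w → IsPerm n w × (pinnacles w ≡ 𝒜)

-- number of maximal nonempty factors (blocks t₁,…,t_k) of elements
-- satisfying P in the word; `prev` records whether the previous letter satisfied P
blocksAux : (ℕ → Bool) → Bool → List ℕ → ℕ
blocksAux P prev [] = 0
blocksAux P prev (a ∷ as) with P a
... | true  = (if prev then 0 else 1) + blocksAux P true as
... | false = blocksAux P false as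

blocks : (ℕ → Bool) → List ℕ → ℕ
blocks P w = blocksAux P false w

-- S_x = [1,x] ∩ S  as a membership predicate (within an ordering of S)
inSx : ℕ → ℕ → Bool
inSx x y = y ≤ᵇ x

-- T = S_x is interrupted (k - 1) times in 𝒜, where k is the number of blocks
interruptions : ℕ → List ℕ → ℤ
interruptions x 𝒜 = (+ blocks (inSx x) 𝒜) ℤ.- (+ 1)

cardSx : List ℕ → ℕ → ℕ
cardSx S x = length (filter (λ y → y ∈? S) (interval x))

cardSbarx : List ℕ → ℕ → ℕ
cardSbarx S x = length (filter (λ y → ¬? (y ∈? S)) (interval x))

kx : List ℕ → ℕ → ℤ
kx S x = ((+ cardSbarx S x) ℤ.- (+ cardSx S x)) ℤ.- (+ 1)

-- x_i for 1-indexed i (default 0 out of range; only used in range)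
nth : List ℕ → ℕ → ℕ
nth [] _ = 0
nth (a ∷ as) zero = a
nth (a ∷ as) (suc k) = nth as k

xAt : List ℕ → ℕ → ℕ
xAt S i = nth S (i ∸ 1)

-- Write b_x for the number of blocks of S_x in 𝒜.  As |S_x| + |S̄_x| = x, the bound on the
-- interruptions of S_x reads b_x + 2|S_x| ≤ x.
--
-- The bound is necessary: in a permutation of [1,n] a pinnacle in S_x has both neighbours below
-- it, and consecutive pinnacles of a block are separated by at least one valley, so a block of m
-- pinnacles occupies 2m+1 values ≤ x, and different blocks occupy disjoint stretches of the word.
--
-- It is sufficient once it holds at every x ∈ S: remove the largest pinnacle M, realise the rest
-- recursively as a zigzag word whose valleys are values outside S, and put M back next to its
-- larger neighbour b, with the largest unused value below b as new valley.  The bound at the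
-- pinnacles of the word is exactly what makes such a value available at every step.
--
-- Finally the bound at every x_i follows from the bound at the indices singled out in the
-- statement.  Admissibility of S gives x_i ≥ 2i+1, one has b_{x_i} ≤ min(i, p−i+1), and b changes
-- by at most one between consecutive indices; so an index with x_i > x_{i-1}+2 inherits the bound
-- from i−1, an index with x_{i+1} ≤ x_i+1 inherits it from i+1, and following these one reaches an
-- index where b ≤ 1, x_i ≥ min(p+i+1, 3i), or the hypothesis of the statement applies.

module Submission where

open import Defs
open import Data.Bool.Base using (Bool; true; false; _∧_; not; if_then_else_)
open import Data.Bool.Properties using (T-≡; ∧-zeroʳ; ∧-identityʳ)
open import Data.Nat.Base
open import Data.Nat.Properties
open import Data.Nat.Tactic.RingSolver using (solve-∀)
open import Data.Integer as ℤ using (+≤+)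
import Data.Integer.Properties as ℤ
import Data.Integer.Tactic.RingSolver as ℤ-Solver
open import Data.Unit.Base using (⊤; tt)
open import Data.Product using (_×_; _,_; proj₁; proj₂; ∃; ∃₂)
open import Data.Sum using (_⊎_; inj₁; inj₂; [_,_]′)
open import Data.List.Base using (List; []; _∷_; _++_; [_]; length; filter; map; upTo; initLast; _∷ʳ′_)
open import Data.List.Properties
  using (length-map; length-upTo; map-++; upTo-∷ʳ; ++-assoc; ++-identityʳ; ∷-injective; filter-all; partition-defn)
open import Data.List.Relation.Unary.All as All using (All; []; _∷_)
import Data.List.Relation.Unary.All.Properties as All
open import Data.List.Relation.Unary.AllPairs as AllPairs using (AllPairs; []; _∷_)
import Data.List.Relation.Unary.AllPairs.Properties as AllPairs
open import Data.List.Relation.Unary.Any using (here; there)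
open import Data.List.Relation.Unary.Linked using (Linked; []; [-]; _∷_)
open import Data.List.Relation.Unary.Unique.Propositional using (Unique)
open import Data.List.Membership.Propositional using (_∈_)
open import Data.List.Membership.Propositional.Properties
  using (∈-map⁺; ∈-map⁻; ∈-upTo⁺; ∈-upTo⁻; ∈-filter⁺; ∈-filter⁻; ∈-++⁺ʳ; ∈-++⁻; ∈-∃++)
open import Data.List.Membership.DecPropositional _≟_ using (_∈?_)
open import Data.List.Relation.Binary.Permutation.Propositional as ↭
  using (_↭_; ↭-refl; ↭-sym; ↭-trans; prep; swap; ↭⇒↭ₛ; ↭ₛ⇒↭)
open import Data.List.Relation.Binary.Permutation.Propositional.Properties
  using (shift; ++⁺; ++⁺ˡ; ++⁺ʳ; ++-comm; All-resp-↭; ∈-resp-↭; ↭-length)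
import Data.List.Relation.Binary.Permutation.Setoid.Properties as ↭ₛ
open import Data.List.Extrema ≤-totalOrder using (max; ⊥≤max; xs≤max; argmax-sel)
open import Relation.Binary.Properties.DecTotalOrder ≤-decTotalOrder using (≥-decTotalOrder)
open import Data.List.Sort ≥-decTotalOrder using (sort; sort-↭; sort-↗)
open import Relation.Binary.PropositionalEquality
  using (_≡_; refl; cong; cong₂; sym; trans; subst; subst₂; setoid; module ≡-Reasoning)
open import Relation.Nullary using (Dec; yes; no; does; contradiction)
open import Relation.Nullary.Decidable using (¬?)
open import Relation.Unary using (Pred; Decidable)
open import Relation.Unary.Properties using (∁?)
open import Function.Base using (_∘_; id)
open import Function.Bundles using (_⇔_; mk⇔; Equivalence)

≤⇒≤ᵇ≡true : ∀ {m n} → m ≤ n → (m ≤ᵇ n) ≡ true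
≤⇒≤ᵇ≡true m≤n = Equivalence.to T-≡ (≤⇒≤ᵇ m≤n)

≤ᵇ≡true⇒≤ : ∀ {m n} → (m ≤ᵇ n) ≡ true → m ≤ n
≤ᵇ≡true⇒≤ {m} {n} e = ≤ᵇ⇒≤ m n (Equivalence.from T-≡ e)

>⇒≤ᵇ≡false : ∀ {m n} → n < m → (m ≤ᵇ n) ≡ false
>⇒≤ᵇ≡false {m} {n} n<m with m ≤ᵇ n in e
... | false = refl
... | true = contradiction (≤ᵇ≡true⇒≤ e) (<⇒≱ n<m)

indicator : Bool → ℕ
indicator true = 1
indicator false = 0

count : {A : Set} → (A → Bool) → List A → ℕ
count P [] = 0
count P (a ∷ as) = indicator (P a) + count P as

_⊆ᵇ_ : {A : Set} → (A → Bool) → (A → Bool) → Set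
P ⊆ᵇ Q = ∀ y → P y ≡ true → Q y ≡ true

_∖ᵇ_ : {A : Set} → (A → Bool) → (A → Bool) → A → Bool
(Q ∖ᵇ P) y = Q y ∧ not (P y)

module _ {A : Set} where

  count-++ : ∀ (P : A → Bool) xs ys → count P (xs ++ ys) ≡ count P xs + count P ys
  count-++ P [] ys = refl
  count-++ P (a ∷ xs) ys =
    trans (cong (indicator (P a) +_) (count-++ P xs ys)) (sym (+-assoc (indicator (P a)) _ _))

  count-↭ : ∀ (P : A → Bool) {xs ys} → xs ↭ ys → count P xs ≡ count P ys
  count-↭ P ↭.refl = refl
  count-↭ P (↭.prep x p) = cong (indicator (P x) +_) (count-↭ P p)
  count-↭ P (↭.swap x y p) =
    trans (cong (λ c → indicator (P x) + (indicator (P y) + c)) (count-↭ P p))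
          (x+[y+z]≡y+[x+z] (indicator (P x)) (indicator (P y)) _)
    where
    x+[y+z]≡y+[x+z] : ∀ x y z → x + (y + z) ≡ y + (x + z)
    x+[y+z]≡y+[x+z] = solve-∀
  count-↭ P (↭.trans p q) = trans (count-↭ P p) (count-↭ P q)

  count-cong : ∀ {P Q : A → Bool} xs → All (λ y → P y ≡ Q y) xs → count P xs ≡ count Q xs
  count-cong [] [] = refl
  count-cong {Q = Q} (a ∷ xs) (e ∷ es) rewrite e = cong (indicator (Q a) +_) (count-cong xs es)

  count-all : ∀ {P : A → Bool} xs → All (λ y → P y ≡ true) xs → count P xs ≡ length xs
  count-all [] [] = refl
  count-all (a ∷ xs) (e ∷ es) rewrite e = cong suc (count-all xs es)

  count-none : ∀ {P : A → Bool} xs → All (λ y → P y ≡ false) xs → count P xs ≡ 0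
  count-none [] [] = refl
  count-none (a ∷ xs) (e ∷ es) rewrite e = count-none xs es

  count-pos : ∀ {P : A → Bool} {a} xs → a ∈ xs → P a ≡ true → 1 ≤ count P xs
  count-pos (b ∷ xs) (here refl) e rewrite e = s≤s z≤n
  count-pos {P} (b ∷ xs) (there a∈xs) e = ≤-trans (count-pos xs a∈xs e) (m≤n+m _ (indicator (P b)))

  count-⊆ : ∀ {P Q : A → Bool} → P ⊆ᵇ Q → ∀ xs → count Q xs ≡ count P xs + count (Q ∖ᵇ P) xs
  count-⊆ P⊆Q [] = refl
  count-⊆ {P} {Q} P⊆Q (a ∷ xs) with P a in p | Q a in q
  ... | true  | true  = cong suc (count-⊆ P⊆Q xs)
  ... | false | true  = trans (cong suc (count-⊆ P⊆Q xs)) (sym (+-suc _ _))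
  ... | false | false = count-⊆ P⊆Q xs
  ... | true  | false with () ← trans (sym (P⊆Q a p)) q

  count+count-not≡length : ∀ (P : A → Bool) xs → count P xs + count (not ∘ P) xs ≡ length xs
  count+count-not≡length P xs =
    trans (sym (count-⊆ (λ _ _ → refl) xs)) (count-all xs (All.tabulate λ _ → refl))

  length-filter≡count : ∀ {p} {P : Pred A p} (P? : Decidable P) xs →
    length (filter P? xs) ≡ count (λ y → does (P? y)) xs
  length-filter≡count P? [] = refl
  length-filter≡count P? (a ∷ xs) with P? a
  ... | yes _ = cong suc (length-filter≡count P? xs)
  ... | no _ = length-filter≡count P? xs

module _ (P : ℕ → Bool) where

  blocksAux-∷ : ∀ f a as → blocksAux P f (a ∷ as) ≡ indicator (P a ∧ not f) + blocksAux P (P a) as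
  blocksAux-∷ f a as with P a
  ... | false = refl
  blocksAux-∷ false a as | true = refl
  blocksAux-∷ true a as | true = refl

  blocksAux-true≤false : ∀ as → blocksAux P true as ≤ blocksAux P false as
  blocksAux-true≤false [] = z≤n
  blocksAux-true≤false (a ∷ as) rewrite blocksAux-∷ true a as | blocksAux-∷ false a as =
    +-monoˡ-≤ _ (indicator-mono (P a))
    where
    indicator-mono : ∀ b → indicator (b ∧ false) ≤ indicator (b ∧ true)
    indicator-mono false = z≤n
    indicator-mono true = z≤n

  blocksAux-skip : ∀ f M R → P M ≡ false → blocksAux P f (M ∷ R) ≡ blocksAux P false R
  blocksAux-skip f M R PM rewrite blocksAux-∷ f M R | PM = refl

  blocksAux-start : ∀ r R → P r ≡ true → blocksAux P false (r ∷ R) ≡ suc (blocksAux P true (r ∷ R))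
  blocksAux-start r R Pr rewrite blocksAux-∷ false r R | blocksAux-∷ true r R | Pr = refl

  blocks-delete : ∀ f L M R → P M ≡ false → blocksAux P f (L ++ R) ≤ blocksAux P f (L ++ M ∷ R)
  blocks-delete false [] M R PM rewrite blocksAux-skip false M R PM = ≤-refl
  blocks-delete true [] M R PM rewrite blocksAux-skip true M R PM = blocksAux-true≤false R
  blocks-delete f (a ∷ L) M R PM
    rewrite blocksAux-∷ f a (L ++ R) | blocksAux-∷ f a (L ++ M ∷ R) =
    +-monoʳ-≤ _ (blocks-delete (P a) L M R PM)

  blocks-merge : ∀ f L l M r R → P l ≡ true → P M ≡ false → P r ≡ true →
    blocksAux P f (L ++ l ∷ M ∷ r ∷ R) ≡ suc (blocksAux P f (L ++ l ∷ r ∷ R))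
  blocks-merge f [] l M r R Pl PM Pr
    rewrite blocksAux-∷ f l (M ∷ r ∷ R) | blocksAux-∷ f l (r ∷ R) | Pl
          | blocksAux-skip true M (r ∷ R) PM | blocksAux-start r R Pr = +-suc _ _
  blocks-merge f (a ∷ L) l M r R Pl PM Pr
    rewrite blocksAux-∷ f a (L ++ l ∷ M ∷ r ∷ R) | blocksAux-∷ f a (L ++ l ∷ r ∷ R)
          | blocks-merge (P a) L l M r R Pl PM Pr = +-suc _ _

  blocks-pos : ∀ {a} as → a ∈ as → P a ≡ true → 1 ≤ blocks P as
  blocks-pos (b ∷ as) (here refl) Pb rewrite blocksAux-∷ false b as | Pb = s≤s z≤n
  blocks-pos (b ∷ as) (there a∈as) Pa with P b
  ... | true = s≤s z≤n
  ... | false = blocks-pos as a∈as Pa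

  blocksAux≤count : ∀ f as → blocksAux P f as ≤ count P as
  blocksAux≤count f [] = z≤n
  blocksAux≤count f (a ∷ as) rewrite blocksAux-∷ f a as =
    +-mono-≤ (indicator-∧ (P a) (not f)) (blocksAux≤count (P a) as)
    where
    indicator-∧ : ∀ b c → indicator (b ∧ c) ≤ indicator b
    indicator-∧ false c = z≤n
    indicator-∧ true false = z≤n
    indicator-∧ true true = ≤-refl

  blocksAux≤count-not : ∀ f as → blocksAux P f as ≤ indicator (not f) + count (not ∘ P) as
  blocksAux≤count-not f [] = z≤n
  blocksAux≤count-not f (a ∷ as) rewrite blocksAux-∷ f a as with P a
  ... | true = +-monoʳ-≤ (indicator (not f)) (blocksAux≤count-not true as)
  ... | false = ≤-trans (blocksAux≤count-not false as) (m≤n+m _ (indicator (not f)))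

module _ {P Q : ℕ → Bool} (P⊆Q : P ⊆ᵇ Q) where

  private
    start-⊆ : ∀ p q f g → (p ≡ true → q ≡ true) → (f ≡ true → g ≡ true) →
      indicator (p ∧ not f) ≤ indicator (q ∧ not g) + indicator (g ∧ not f)
    start-⊆ false q f g _ _ = z≤n
    start-⊆ true q true g _ _ = z≤n
    start-⊆ true true false true _ _ = s≤s z≤n
    start-⊆ true true false false _ _ = s≤s z≤n
    start-⊆ true false false g p⇒q _ with () ← p⇒q refl

    start-⊇ : ∀ p q f g → (p ≡ true → q ≡ true) → (f ≡ true → g ≡ true) →
      indicator (q ∧ not g) ≤ indicator (p ∧ not f) + indicator (q ∧ not p)
    start-⊇ p false f g _ _ = z≤n
    start-⊇ p true f true _ _ = z≤n
    start-⊇ p true true false _ f⇒g with () ← f⇒g refl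
    start-⊇ true true false false _ _ = s≤s z≤n
    start-⊇ false true false false _ _ = s≤s z≤n

  -- A block of P that does not start a block of Q starts right after a letter of Q ∖ᵇ P.
  blocksAux-⊆ : ∀ f g → (f ≡ true → g ≡ true) → ∀ as →
    blocksAux P f as ≤ blocksAux Q g as + count (Q ∖ᵇ P) as + indicator (g ∧ not f)
  blocksAux-⊆ f g f⇒g [] = z≤n
  blocksAux-⊆ f g f⇒g (a ∷ as) rewrite blocksAux-∷ P f a as | blocksAux-∷ Q g a as =
    ≤-trans (+-mono-≤ (start-⊆ (P a) (Q a) f g (P⊆Q a) f⇒g) (blocksAux-⊆ (P a) (Q a) (P⊆Q a) as))
            (≤-reflexive (rearrange (indicator (Q a ∧ not g)) (indicator (g ∧ not f)) (blocksAux Q (Q a) as)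
                                    (count (Q ∖ᵇ P) as) (indicator (Q a ∧ not (P a)))))
    where
    rearrange : ∀ i j X C k → (i + j) + (X + C + k) ≡ i + X + (k + C) + j
    rearrange = solve-∀

  blocksAux-⊇ : ∀ f g → (f ≡ true → g ≡ true) → ∀ as →
    blocksAux Q g as ≤ blocksAux P f as + count (Q ∖ᵇ P) as
  blocksAux-⊇ f g f⇒g [] = z≤n
  blocksAux-⊇ f g f⇒g (a ∷ as) rewrite blocksAux-∷ P f a as | blocksAux-∷ Q g a as =
    ≤-trans (+-mono-≤ (start-⊇ (P a) (Q a) f g (P⊆Q a) f⇒g) (blocksAux-⊇ (P a) (Q a) (P⊆Q a) as))
            (≤-reflexive (rearrange (indicator (P a ∧ not f)) (indicator (Q a ∧ not (P a)))
                                    (blocksAux P (P a) as) (count (Q ∖ᵇ P) as)))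
    where
    rearrange : ∀ i k X C → (i + k) + (X + C) ≡ i + X + (k + C)
    rearrange = solve-∀

  blocks-⊆ : ∀ as → blocks P as ≤ blocks Q as + count (Q ∖ᵇ P) as
  blocks-⊆ as = ≤-trans (blocksAux-⊆ false false (λ ()) as) (≤-reflexive (+-identityʳ _))

  blocks-⊇ : ∀ as → blocks Q as ≤ blocks P as + count (Q ∖ᵇ P) as
  blocks-⊇ = blocksAux-⊇ false false (λ ())

inSx-mono : ∀ {x y} → x ≤ y → inSx x ⊆ᵇ inSx y
inSx-mono x≤y z z≤x = ≤⇒≤ᵇ≡true (≤-trans (≤ᵇ≡true⇒≤ {z} z≤x) x≤y)

interval-suc : ∀ n → interval (suc n) ≡ interval n ++ [ suc n ]
interval-suc n = trans (cong (map suc) (sym (upTo-∷ʳ n))) (map-++ suc (upTo n) [ n ])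

length-interval : ∀ n → length (interval n) ≡ n
length-interval n = trans (length-map suc (upTo n)) (length-upTo n)

∈-interval⁻ : ∀ {z n} → z ∈ interval n → 1 ≤ z × z ≤ n
∈-interval⁻ z∈ with _ , i∈ , refl ← ∈-map⁻ suc z∈ = s≤s z≤n , ∈-upTo⁻ i∈

∈-interval⁺ : ∀ {z n} → 1 ≤ z → z ≤ n → z ∈ interval n
∈-interval⁺ {suc z} _ z<n = ∈-map⁺ suc (∈-upTo⁺ z<n)

interval-sorted : ∀ n → AllPairs _<_ (interval n)
interval-sorted n = AllPairs.map⁺ (AllPairs.applyUpTo⁺₁ id n (λ i<j _ → s≤s i<j))

count-interval-snoc : ∀ (P : ℕ → Bool) n →
  count P (interval (suc n)) ≡ count P (interval n) + indicator (P (suc n))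
count-interval-snoc P n =
  trans (cong (count P) (interval-suc n))
        (trans (count-++ P (interval n) [ suc n ]) (cong (count P (interval n) +_) (+-identityʳ _)))

count-<-interval-all : ∀ x n → n < x → count (_<ᵇ x) (interval n) ≡ n
count-<-interval-all x zero _ = refl
count-<-interval-all x (suc n) n<x
  rewrite count-interval-snoc (_<ᵇ x) n | count-<-interval-all x n (<-trans (n<1+n n) n<x)
        | ≤⇒≤ᵇ≡true n<x = +-comm n 1

count-<-interval : ∀ x n → x ≤ suc n → count (_<ᵇ x) (interval n) ≡ x ∸ 1
count-<-interval x zero x≤1 = sym (m≤n⇒m∸n≡0 x≤1)
count-<-interval x (suc n) x≤2+n with x ≤? suc n
... | yes x≤1+n rewrite count-interval-snoc (_<ᵇ x) n | count-<-interval x n x≤1+n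
                      | >⇒≤ᵇ≡false (s≤s x≤1+n) = +-identityʳ (x ∸ 1)
... | no x≰1+n rewrite ≤-antisym x≤2+n (≰⇒> x≰1+n) = count-<-interval-all (suc (suc n)) (suc n) ≤-refl

count-≤-interval : ∀ x n → x ≤ n → count (_≤ᵇ x) (interval n) ≡ x
count-≤-interval x n x≤n =
  trans (count-cong (interval n) (All.tabulate λ {y} _ → ≤ᵇ≡<ᵇ-suc y))
        (count-<-interval (suc x) n (s≤s x≤n))
  where
  ≤ᵇ≡<ᵇ-suc : ∀ y → (y ≤ᵇ x) ≡ (y <ᵇ suc x)
  ≤ᵇ≡<ᵇ-suc zero = refl
  ≤ᵇ≡<ᵇ-suc (suc y) = refl

strictlySorted-≡ : ∀ {xs ys : List ℕ} → AllPairs _<_ xs → AllPairs _<_ ys →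
  (∀ {z} → z ∈ xs → z ∈ ys) → (∀ {z} → z ∈ ys → z ∈ xs) → xs ≡ ys
strictlySorted-≡ {[]} {[]} _ _ _ _ = refl
strictlySorted-≡ {[]} {y ∷ ys} _ _ _ ys⊆xs with () ← ys⊆xs (here refl)
strictlySorted-≡ {x ∷ xs} {[]} _ _ xs⊆ys _ with () ← xs⊆ys (here refl)
strictlySorted-≡ {x ∷ xs} {y ∷ ys} (x<xs ∷ sxs) (y<ys ∷ sys) xs⊆ys ys⊆xs =
  cong₂ _∷_ x≡y (strictlySorted-≡ sxs sys (tail⊆ x<xs xs⊆ys x≡y) (tail⊆ y<ys ys⊆xs (sym x≡y)))
  where
  head≤ : ∀ {a b as} → All (a <_) as → b ∈ a ∷ as → a ≤ b
  head≤ _ (here refl) = ≤-refl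
  head≤ a<as (there b∈as) = <⇒≤ (All.lookup a<as b∈as)
  x≡y : x ≡ y
  x≡y = ≤-antisym (head≤ x<xs (ys⊆xs (here refl))) (head≤ y<ys (xs⊆ys (here refl)))
  tail⊆ : ∀ {a b as bs} → All (a <_) as → (∀ {z} → z ∈ a ∷ as → z ∈ b ∷ bs) → a ≡ b →
    ∀ {z} → z ∈ as → z ∈ bs
  tail⊆ a<as as⊆bs refl z∈as with as⊆bs (there z∈as)
  ... | here refl = contradiction (All.lookup a<as z∈as) (<-irrefl refl)
  ... | there z∈bs = z∈bs

unique-↭ : ∀ {xs ys : List ℕ} → xs ↭ ys → Unique xs → Unique ys
unique-↭ xs↭ys = ↭ₛ.Unique-resp-↭ (setoid ℕ) (↭⇒↭ₛ xs↭ys)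

filter-partition-↭ : ∀ {A : Set} {p} {P : Pred A p} (P? : Decidable P) xs → xs ↭ filter P? xs ++ filter (∁? P?) xs
filter-partition-↭ P? xs =
  subst (λ (ys , zs) → xs ↭ ys ++ zs) (partition-defn P? xs) (↭ₛ⇒↭ (↭ₛ.partition-↭ (setoid _) P? xs))

length≡0⇒≡[] : ∀ {A : Set} {xs : List A} → length xs ≡ 0 → xs ≡ []
length≡0⇒≡[] {xs = []} _ = refl

filter-∈-interval : ∀ {S} n → AllPairs _<_ S → All (1 ≤_) S →
  filter (_∈? S) (interval n) ≡ filter (_≤? n) S
filter-∈-interval {S} n sorted positive =
  strictlySorted-≡ (AllPairs.filter⁺ (_∈? S) (interval-sorted n)) (AllPairs.filter⁺ (_≤? n) sorted) ⊆ ⊇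
  where
  ⊆ : ∀ {z} → z ∈ filter (_∈? S) (interval n) → z ∈ filter (_≤? n) S
  ⊆ z∈ with z∈I , z∈S ← ∈-filter⁻ (_∈? S) {xs = interval n} z∈ = ∈-filter⁺ (_≤? n) z∈S (proj₂ (∈-interval⁻ z∈I))
  ⊇ : ∀ {z} → z ∈ filter (_≤? n) S → z ∈ filter (_∈? S) (interval n)
  ⊇ z∈ with z∈S , z≤bound ← ∈-filter⁻ (_≤? n) {xs = S} z∈ =
    ∈-filter⁺ (_∈? S) (∈-interval⁺ (All.lookup positive z∈S) z≤bound) z∈S

cardSx≡count : ∀ {S} x → AllPairs _<_ S → All (1 ≤_) S → cardSx S x ≡ count (_≤ᵇ x) S
cardSx≡count {S} x sorted positive =
  trans (cong length (filter-∈-interval x sorted positive)) (length-filter≡count (_≤? x) S)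

cardSx+cardSbarx : ∀ S x → cardSx S x + cardSbarx S x ≡ x
cardSx+cardSbarx S x =
  trans (cong₂ _+_ (length-filter≡count (_∈? S) (interval x)) (length-filter≡count (λ y → ¬? (y ∈? S)) (interval x)))
        (trans (count+count-not≡length (λ y → does (y ∈? S)) (interval x)) (length-interval x))

nth∈ : ∀ S i → i < length S → nth S i ∈ S
nth∈ (a ∷ S) zero _ = here refl
nth∈ (a ∷ S) (suc i) i<len = there (nth∈ S i (s≤s⁻¹ i<len))

∈⇒nth : ∀ {z} S → z ∈ S → ∃ λ i → i < length S × nth S i ≡ z
∈⇒nth (a ∷ S) (here refl) = 0 , s≤s z≤n , refl
∈⇒nth (a ∷ S) (there z∈S) with i , i<len , refl ← ∈⇒nth S z∈S = suc i , s≤s i<len , refl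

nth-< : ∀ S i → AllPairs _<_ S → suc i < length S → nth S i < nth S (suc i)
nth-< (a ∷ S) zero (a<S ∷ _) i<len = All.lookup a<S (nth∈ S 0 (s≤s⁻¹ i<len))
nth-< (a ∷ S) (suc i) (_ ∷ sorted) i<len = nth-< S i sorted (s≤s⁻¹ i<len)

count-≤-nth : ∀ S i → AllPairs _<_ S → i < length S → count (_≤ᵇ nth S i) S ≡ suc i
count-≤-nth (a ∷ S) zero (a<S ∷ _) _
  rewrite ≤⇒≤ᵇ≡true (≤-refl {a}) = cong suc (count-none S (All.map >⇒≤ᵇ≡false a<S))
count-≤-nth (a ∷ S) (suc i) (a<S ∷ sorted) i<len
  rewrite ≤⇒≤ᵇ≡true (<⇒≤ (All.lookup a<S (nth∈ S i (s≤s⁻¹ i<len)))) =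
  cong suc (count-≤-nth S i sorted (s≤s⁻¹ i<len))

count-<-nth : ∀ S i → AllPairs _<_ S → i < length S → count (_<ᵇ nth S i) S ≡ i
count-<-nth (a ∷ S) zero (a<S ∷ _) _
  rewrite >⇒≤ᵇ≡false (≤-refl {suc a}) = count-none S (All.map (λ a<y → >⇒≤ᵇ≡false (s≤s (<⇒≤ a<y))) a<S)
count-<-nth (a ∷ S) (suc i) (a<S ∷ sorted) i<len
  rewrite ≤⇒≤ᵇ≡true (All.lookup a<S (nth∈ S i (s≤s⁻¹ i<len))) =
  cong suc (count-<-nth S i sorted (s≤s⁻¹ i<len))

-- Necessity

pinnacles-descent : ∀ a b r → b ≤ a → pinnacles (a ∷ b ∷ r) ≡ pinnacles (b ∷ r)
pinnacles-descent a b [] _ = refl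
pinnacles-descent a b (c ∷ r) b≤a rewrite >⇒≤ᵇ≡false (s≤s b≤a) = refl

peak⇒< : ∀ {a b c} → (a <ᵇ b) ∧ (c <ᵇ b) ≡ true → a < b × c < b
peak⇒< {a} {b} peak with a <ᵇ b in a<b
... | true = ≤ᵇ≡true⇒≤ a<b , ≤ᵇ≡true⇒≤ peak

demand : ℕ → Bool → List ℕ → ℕ
demand x f ps = count (inSx x) ps + count (inSx x) ps + blocksAux (inSx x) f ps

demand-∷-out : ∀ x f b ps → inSx x b ≡ false → demand x f (b ∷ ps) ≡ demand x false ps
demand-∷-out x f b ps b>x rewrite blocksAux-skip (inSx x) f b ps b>x | b>x = refl

demand-∷-in : ∀ x f b ps → inSx x b ≡ true → demand x f (b ∷ ps) ≡ 2 + indicator (not f) + demand x true ps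
demand-∷-in x f b ps b≤x rewrite blocksAux-∷ (inSx x) f b ps | b≤x =
  rearrange (count (inSx x) ps) (indicator (not f)) (blocksAux (inSx x) true ps)
  where
  rearrange : ∀ k i B → suc k + suc k + (i + B) ≡ 2 + i + (k + k + B)
  rearrange = solve-∀

demand-step : ∀ x a b c r f g → (f ≡ false → g ≡ true) →
  demand x f (pinnacles (b ∷ c ∷ r)) ≤ count (inSx x) (c ∷ r) + indicator (inSx x b) →
  demand x false (pinnacles (c ∷ r)) ≤ count (inSx x) r + indicator (inSx x c) →
  demand x true (pinnacles (c ∷ r)) ≤ count (inSx x) r + 0 →
  demand x f (pinnacles (a ∷ b ∷ c ∷ r)) ≤ count (inSx x) (b ∷ c ∷ r) + indicator (g ∧ inSx x a)
demand-step x a b c r f g fresh ih-b ih-c-open ih-c-closed with (a <ᵇ b) ∧ (c <ᵇ b) in peak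
... | false = begin
  demand x f (pinnacles (b ∷ c ∷ r))       ≤⟨ ih-b ⟩
  count (inSx x) (c ∷ r) + indicator (inSx x b) ≡⟨ +-comm (count (inSx x) (c ∷ r)) _ ⟩
  count (inSx x) (b ∷ c ∷ r)               ≤⟨ m≤m+n _ _ ⟩
  count (inSx x) (b ∷ c ∷ r) + indicator (g ∧ inSx x a) ∎
  where open ≤-Reasoning
... | true with a<b , c<b ← peak⇒< peak rewrite pinnacles-descent b c r (<⇒≤ c<b) with b ≤? x
...   | no b≰x = begin
  demand x f (b ∷ pinnacles (c ∷ r))       ≡⟨ demand-∷-out x f b _ (>⇒≤ᵇ≡false (≰⇒> b≰x)) ⟩
  demand x false (pinnacles (c ∷ r))       ≤⟨ ih-c-open ⟩
  count (inSx x) r + indicator (inSx x c)  ≡⟨ +-comm (count (inSx x) r) _ ⟩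
  count (inSx x) (c ∷ r)                   ≤⟨ m≤n+m (count (inSx x) (c ∷ r)) (indicator (inSx x b)) ⟩
  count (inSx x) (b ∷ c ∷ r)               ≤⟨ m≤m+n _ _ ⟩
  count (inSx x) (b ∷ c ∷ r) + indicator (g ∧ inSx x a) ∎
  where open ≤-Reasoning
...   | yes b≤x = begin
  demand x f (b ∷ pinnacles (c ∷ r))            ≡⟨ demand-∷-in x f b _ (≤⇒≤ᵇ≡true b≤x) ⟩
  2 + indicator (not f) + demand x true (pinnacles (c ∷ r))
    ≤⟨ +-mono-≤ (+-monoʳ-≤ 2 (fresh⇒ f g fresh)) ih-c-closed ⟩
  2 + indicator g + (count (inSx x) r + 0)      ≡⟨ cong (2 + indicator g +_) (+-identityʳ _) ⟩
  2 + indicator g + count (inSx x) r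
    ≡⟨ sym (count-peak (≤⇒≤ᵇ≡true (≤-trans (<⇒≤ a<b) b≤x)) (≤⇒≤ᵇ≡true b≤x) (≤⇒≤ᵇ≡true (≤-trans (<⇒≤ c<b) b≤x))) ⟩
  count (inSx x) (b ∷ c ∷ r) + indicator (g ∧ inSx x a) ∎
  where
  open ≤-Reasoning
  fresh⇒ : ∀ f g → (f ≡ false → g ≡ true) → indicator (not f) ≤ indicator g
  fresh⇒ true g _ = z≤n
  fresh⇒ false g fresh rewrite fresh refl = ≤-refl
  count-peak : inSx x a ≡ true → inSx x b ≡ true → inSx x c ≡ true →
    count (inSx x) (b ∷ c ∷ r) + indicator (g ∧ inSx x a) ≡ 2 + indicator g + count (inSx x) r
  count-peak a≤x b≤x c≤x rewrite a≤x | b≤x | c≤x | ∧-identityʳ g =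
    cong (2 +_) (+-comm (count (inSx x) r) (indicator g))

-- Each pinnacle ≤ x is charged for itself and its right neighbour, and each block also for the
-- left neighbour of its first pinnacle; f records whether a block is open, g whether a is uncharged.
demand-pinnacles-∷ : ∀ x a t f g → (f ≡ false → g ≡ true) →
  demand x f (pinnacles (a ∷ t)) ≤ count (inSx x) t + indicator (g ∧ inSx x a)
demand-pinnacles-∷ x a [] f g _ = z≤n
demand-pinnacles-∷ x a (b ∷ []) f g _ = z≤n
demand-pinnacles-∷ x a (b ∷ c ∷ r) f g fresh =
  demand-step x a b c r f g fresh (demand-pinnacles-∷ x b (c ∷ r) f true (λ _ → refl))
    (demand-pinnacles-∷ x c r false true (λ _ → refl)) (demand-pinnacles-∷ x c r true false (λ ()))

demand-pinnacles : ∀ x w → demand x false (pinnacles w) ≤ count (inSx x) w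
demand-pinnacles x [] = z≤n
demand-pinnacles x (a ∷ t) =
  ≤-trans (demand-pinnacles-∷ x a t false true (λ _ → refl)) (≤-reflexive (+-comm (count (inSx x) t) _))

∈-pinnacles-∷ : ∀ {x} a b c r → x ∈ pinnacles (a ∷ b ∷ c ∷ r) → x ≡ b ⊎ x ∈ pinnacles (b ∷ c ∷ r)
∈-pinnacles-∷ a b c r x∈ with ∈-++⁻ (if (a <ᵇ b) ∧ (c <ᵇ b) then b ∷ [] else []) x∈
... | inj₁ x∈peak = inj₁ (∈-if-[] ((a <ᵇ b) ∧ (c <ᵇ b)) x∈peak)
  where
  ∈-if-[] : ∀ {x} p → x ∈ (if p then b ∷ [] else []) → x ≡ b
  ∈-if-[] true (here x≡b) = x≡b
... | inj₂ x∈rest = inj₂ x∈rest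

pinnacles⊆ : ∀ {x} w → x ∈ pinnacles w → x ∈ w
pinnacles⊆ (a ∷ b ∷ c ∷ r) x∈ =
  [ (λ x≡b → there (here x≡b)) , (λ x∈rest → there (pinnacles⊆ (b ∷ c ∷ r) x∈rest)) ]′ (∈-pinnacles-∷ a b c r x∈)

demand-permutation : ∀ {n w} x → IsPerm n w → x ≤ n → demand x false (pinnacles w) ≤ x
demand-permutation {n} {w} x w↭ x≤n = begin
  demand x false (pinnacles w) ≤⟨ demand-pinnacles x w ⟩
  count (inSx x) w             ≡⟨ count-↭ (inSx x) w↭ ⟩
  count (inSx x) (interval n)  ≡⟨ count-≤-interval x n x≤n ⟩
  x                            ∎
  where open ≤-Reasoning

-- Zigzag words

zigzag : List (ℕ × ℕ) → ℕ → List ℕ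
zigzag [] v = v ∷ []
zigzag ((u , a) ∷ ps) v = u ∷ a ∷ zigzag ps v

firstValley : List (ℕ × ℕ) → ℕ → ℕ
firstValley [] v = v
firstValley ((u , a) ∷ ps) v = u

IsZigzag : List (ℕ × ℕ) → ℕ → Set
IsZigzag [] v = ⊤
IsZigzag ((u , a) ∷ ps) v = u < a × firstValley ps v < a × IsZigzag ps v

valleys : List (ℕ × ℕ) → ℕ → List ℕ
valleys ps v = map proj₁ ps ++ [ v ]

peaks : List (ℕ × ℕ) → List ℕ
peaks = map proj₂

zigzag-≡-∷ : ∀ ps v → ∃ λ t → zigzag ps v ≡ firstValley ps v ∷ t
zigzag-≡-∷ [] v = [] , refl
zigzag-≡-∷ ((u , a) ∷ ps) v = _ , refl

pinnacles-zigzag : ∀ ps v → IsZigzag ps v → pinnacles (zigzag ps v) ≡ peaks ps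
pinnacles-zigzag [] v _ = refl
pinnacles-zigzag ((u , a) ∷ ps) v (u<a , u'<a , zz) with zigzag-≡-∷ ps v
... | t , ≡∷ rewrite ≡∷ | ≤⇒≤ᵇ≡true u<a | ≤⇒≤ᵇ≡true u'<a = cong (a ∷_) (begin
  pinnacles (a ∷ firstValley ps v ∷ t) ≡⟨ pinnacles-descent a _ t (<⇒≤ u'<a) ⟩
  pinnacles (firstValley ps v ∷ t)     ≡⟨ cong pinnacles (sym ≡∷) ⟩
  pinnacles (zigzag ps v)              ≡⟨ pinnacles-zigzag ps v zz ⟩
  peaks ps                             ∎)
  where open ≡-Reasoning

zigzag-↭ : ∀ ps v → zigzag ps v ↭ peaks ps ++ valleys ps v
zigzag-↭ [] v = ↭-refl
zigzag-↭ ((u , a) ∷ ps) v =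
  ↭-trans (prep u (prep a (zigzag-↭ ps v)))
  (↭-trans (swap u a ↭-refl) (prep a (↭-sym (shift u (peaks ps) (valleys ps v)))))

Descending : List ℕ → Set
Descending = Linked (λ x y → y ≤ x)

StartsUp : List ℕ → Set
StartsUp (y ∷ z ∷ _) = y ≤ z
StartsUp _ = ⊤

zigzag-startsUp : ∀ ps v → IsZigzag ps v → StartsUp (zigzag ps v)
zigzag-startsUp [] v _ = tt
zigzag-startsUp ((u , a) ∷ ps) v (u<a , _) = <⇒≤ u<a

pinnacles-descending-++ : ∀ {D} ys → Descending D → StartsUp ys → pinnacles (D ++ ys) ≡ pinnacles ys
pinnacles-descending-++ ys [] _ = refl
pinnacles-descending-++ [] [-] _ = refl
pinnacles-descending-++ (y ∷ []) [-] _ = refl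
pinnacles-descending-++ {d ∷ []} (y ∷ z ∷ r) [-] y≤z rewrite >⇒≤ᵇ≡false (s≤s y≤z) | ∧-zeroʳ (d <ᵇ y) = refl
pinnacles-descending-++ {d ∷ d′ ∷ D} ys (d′≤d ∷ desc) up =
  trans (pinnacles-descent d d′ (D ++ ys) d′≤d) (pinnacles-descending-++ ys desc up)

record Realisation (A N : List ℕ) (B : ℕ) : Set where
  field
    steps : List (ℕ × ℕ)
    final : ℕ
    unused : List ℕ
    isZigzag : IsZigzag steps final
    peaks≡ : peaks steps ≡ A
    valleys↭ : valleys steps final ++ unused ↭ N
    valleys<B : All (_< B) (valleys steps final)

  -- The unused values go first, in decreasing order, so that they create no pinnacle.
  word : List ℕ
  word = sort unused ++ zigzag steps final

  pinnacles-word : pinnacles word ≡ A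
  pinnacles-word = begin
    pinnacles word                   ≡⟨ pinnacles-descending-++ (zigzag steps final) (sort-↗ unused)
                                                                (zigzag-startsUp steps final isZigzag) ⟩
    pinnacles (zigzag steps final)   ≡⟨ pinnacles-zigzag steps final isZigzag ⟩
    peaks steps                      ≡⟨ peaks≡ ⟩
    A                                ∎
    where open ≡-Reasoning

  word-↭ : word ↭ A ++ N
  word-↭ = begin
    sort unused ++ zigzag steps final                       ↭⟨ ++⁺ (sort-↭ unused) (zigzag-↭ steps final) ⟩
    unused ++ peaks steps ++ valleys steps final            ↭⟨ ++-comm unused _ ⟩
    (peaks steps ++ valleys steps final) ++ unused          ≡⟨ ++-assoc (peaks steps) _ unused ⟩
    peaks steps ++ valleys steps final ++ unused            ↭⟨ ++⁺ˡ (peaks steps) valleys↭ ⟩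
    peaks steps ++ N                                        ≡⟨ cong (_++ N) peaks≡ ⟩
    A ++ N                                                  ∎
    where open ↭.PermutationReasoning

firstValley-++ : ∀ ps qs f → firstValley (ps ++ qs) f ≡ firstValley ps (firstValley qs f)
firstValley-++ [] qs f = refl
firstValley-++ ((u , a) ∷ ps) qs f = refl

isZigzag-++⁻ : ∀ ps qs f → IsZigzag (ps ++ qs) f → IsZigzag ps (firstValley qs f) × IsZigzag qs f
isZigzag-++⁻ [] qs f zz = tt , zz
isZigzag-++⁻ ((u , a) ∷ ps) qs f (u<a , u′<a , zz) with zz-ps , zz-qs ← isZigzag-++⁻ ps qs f zz =
  (u<a , subst (_< a) (firstValley-++ ps qs f) u′<a , zz-ps) , zz-qs

isZigzag-++⁺ : ∀ ps qs f → IsZigzag ps (firstValley qs f) → IsZigzag qs f → IsZigzag (ps ++ qs) f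
isZigzag-++⁺ [] qs f _ zz-qs = zz-qs
isZigzag-++⁺ ((u , a) ∷ ps) qs f (u<a , u′<a , zz-ps) zz-qs =
  u<a , subst (_< a) (sym (firstValley-++ ps qs f)) u′<a , isZigzag-++⁺ ps qs f zz-ps zz-qs

firstValley∈valleys : ∀ ps f → firstValley ps f ∈ valleys ps f
firstValley∈valleys [] f = here refl
firstValley∈valleys ((u , a) ∷ ps) f = here refl

peaks-++⁻ : ∀ ps L R → peaks ps ≡ L ++ R → ∃₂ λ psL psR → ps ≡ psL ++ psR × peaks psL ≡ L × peaks psR ≡ R
peaks-++⁻ ps [] R eq = [] , ps , refl , refl , eq
peaks-++⁻ ((u , a) ∷ ps) (b ∷ L) R eq with refl , eq′ ← ∷-injective eq
                                     with psL , psR , refl , eqL , eqR ← peaks-++⁻ ps L R eq′ =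
  (u , a) ∷ psL , psR , refl , cong (a ∷_) eqL , eqR

peaks-∷⁻ : ∀ ps a as → peaks ps ≡ a ∷ as → ∃₂ λ u qs → ps ≡ (u , a) ∷ qs × peaks qs ≡ as
peaks-∷⁻ ((u , b) ∷ qs) a as eq with refl , eq′ ← ∷-injective eq = u , qs , refl , eq′

valleys-++-↭ : ∀ {v} ps xs ys f → (∀ f → valleys xs f ↭ v ∷ valleys ys f) →
  valleys (ps ++ xs) f ↭ v ∷ valleys (ps ++ ys) f
valleys-++-↭ [] xs ys f xs↭ = xs↭ f
valleys-++-↭ {v} ((u , a) ∷ ps) xs ys f xs↭ = ↭-trans (prep u (valleys-++-↭ ps xs ys f xs↭)) (swap u v ↭-refl)

final∈valleys : ∀ ps f → f ∈ valleys ps f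
final∈valleys ps f = ∈-++⁺ʳ (map proj₁ ps) (here refl)

valleys-++ : ∀ ps qs f → valleys (ps ++ qs) f ≡ map proj₁ ps ++ valleys qs f
valleys-++ ps qs f = trans (cong (_++ [ f ]) (map-++ proj₁ ps qs)) (++-assoc (map proj₁ ps) (map proj₁ qs) [ f ])

valleys-snoc-↭ : ∀ ps f M v → valleys (ps ++ [ (f , M) ]) v ↭ v ∷ valleys ps f
valleys-snoc-↭ ps f M v = begin
  valleys (ps ++ [ (f , M) ]) v       ≡⟨ valleys-++ ps [ (f , M) ] v ⟩
  map proj₁ ps ++ [ f ] ++ [ v ]      ≡⟨ ++-assoc (map proj₁ ps) [ f ] [ v ] ⟨
  valleys ps f ++ [ v ]               ↭⟨ ++-comm (valleys ps f) [ v ] ⟩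
  v ∷ valleys ps f                    ∎
  where open ↭.PermutationReasoning

-- The greedy construction

-- N is the pool of values available as valleys.
Supply : List ℕ → List ℕ → Set
Supply A N = ∀ x → x ∈ A → blocks (inSx x) A + count (inSx x) A ≤ count (_<ᵇ x) N

record LargestBelow (b : ℕ) (N : List ℕ) : Set where
  field
    value : ℕ
    rest : List ℕ
    value<b : value < b
    N↭ : N ↭ value ∷ rest
    largest : All (λ y → y < b → y ≤ value) N

largestBelow-∷ : ∀ {b N} y (lb : LargestBelow b N) → (y < b → y ≤ LargestBelow.value lb) → LargestBelow b (y ∷ N)
largestBelow-∷ y lb y≤v = record
  { value = value ; rest = y ∷ rest ; value<b = value<b
  ; N↭ = ↭-trans (prep y N↭) (swap y value ↭-refl) ; largest = y≤v ∷ largest }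
  where open LargestBelow lb

largestBelow? : ∀ b N → LargestBelow b N ⊎ All (b ≤_) N
largestBelow? b [] = inj₂ []
largestBelow? b (y ∷ N) with largestBelow? b N | y <? b
... | inj₂ N≥b | no y≮b = inj₂ (≮⇒≥ y≮b ∷ N≥b)
... | inj₂ N≥b | yes y<b = inj₁ record
  { value = y ; rest = N ; value<b = y<b ; N↭ = ↭-refl
  ; largest = (λ _ → ≤-refl) ∷ All.map (λ b≤z z<b → contradiction z<b (≤⇒≯ b≤z)) N≥b }
... | inj₁ lb | no y≮b = inj₁ (largestBelow-∷ y lb (λ y<b → contradiction y<b y≮b))
... | inj₁ lb | yes y<b with y ≤? LargestBelow.value lb
...   | yes y≤v = inj₁ (largestBelow-∷ y lb (λ _ → y≤v))
...   | no y≰v = inj₁ record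
  { value = y ; rest = N ; value<b = y<b ; N↭ = ↭-refl
  ; largest = (λ _ → ≤-refl) ∷ All.map (λ below z<b → ≤-trans (below z<b) (<⇒≤ (≰⇒> y≰v))) largest }
  where open LargestBelow lb

largestBelow : ∀ b N → 1 ≤ count (_<ᵇ b) N → LargestBelow b N
largestBelow b N pos with largestBelow? b N
... | inj₁ lb = lb
... | inj₂ N≥b = contradiction (subst (1 ≤_) (count-none N (All.map (λ b≤y → >⇒≤ᵇ≡false (s≤s b≤y)) N≥b)) pos) λ ()

module _ {b N} (lb : LargestBelow b N) where
  open LargestBelow lb

  count-largestBelow : ∀ {x} → value < x → x ≤ b → count (_<ᵇ x) N ≡ count (_<ᵇ b) N
  count-largestBelow {x} v<x x≤b = count-cong N (All.map same largest)
    where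
    same : ∀ {y} → (y < b → y ≤ value) → (y <ᵇ x) ≡ (y <ᵇ b)
    same {y} below with y <? b
    ... | yes y<b = trans (≤⇒≤ᵇ≡true (≤-<-trans (below y<b) v<x)) (sym (≤⇒≤ᵇ≡true y<b))
    ... | no y≮b = trans (>⇒≤ᵇ≡false (s≤s (≤-trans x≤b (≮⇒≥ y≮b)))) (sym (>⇒≤ᵇ≡false (s≤s (≮⇒≥ y≮b))))

-- A′ is A without its maximum M, and b is the larger neighbour of M in A (M itself at an end).
record MaxDeletion (A : List ℕ) (M : ℕ) (A′ : List ℕ) (b : ℕ) : Set where
  field
    A↭ : A ↭ M ∷ A′
    A′<M : All (_< M) A′
    b∈A : b ∈ A
    b≤M : b ≤ M
    blocks≤ : ∀ x → x < M → blocks (inSx x) A′ ≤ blocks (inSx x) A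
    blocks-merged : ∀ x → b ≤ x → x < M → suc (blocks (inSx x) A′) ≡ blocks (inSx x) A
    demand-drop : suc (blocks (inSx b) A′ + count (inSx b) A′) ≤ blocks (inSx b) A + count (inSx b) A

  M∈A : M ∈ A
  M∈A = ∈-resp-↭ (↭-sym A↭) (here refl)

  count-delete : ∀ x → x < M → count (inSx x) A ≡ count (inSx x) A′
  count-delete x x<M rewrite count-↭ (inSx x) A↭ | >⇒≤ᵇ≡false x<M = refl

  unique-delete : Unique A → Unique A′
  unique-delete uniq with _ ∷ uniq′ ← unique-↭ A↭ uniq = uniq′

module _ {A M A′ b N} (D : MaxDeletion A M A′ b) (supply : Supply A N) where
  open MaxDeletion D

  largestBelow-neighbour : LargestBelow b N
  largestBelow-neighbour = largestBelow b N (≤-trans (count-pos A b∈A (≤⇒≤ᵇ≡true (≤-refl {b})))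
                                                     (≤-trans (m≤n+m _ _) (supply b b∈A)))

  open LargestBelow largestBelow-neighbour

  count-N : ∀ x → count (_<ᵇ x) N ≡ indicator (value <ᵇ x) + count (_<ᵇ x) rest
  count-N x = count-↭ (_<ᵇ x) N↭

  supply-strict : ∀ x → x ∈ A′ → value < x → suc (blocks (inSx x) A′ + count (inSx x) A′) ≤ count (_<ᵇ x) N
  supply-strict x x∈A′ v<x with x<M ← All.lookup A′<M x∈A′ | b ≤? x
  ... | yes b≤x = begin
    suc (blocks (inSx x) A′ + count (inSx x) A′) ≡⟨ cong₂ _+_ (blocks-merged x b≤x x<M) (sym (count-delete x x<M)) ⟩
    blocks (inSx x) A + count (inSx x) A         ≤⟨ supply x (∈-resp-↭ (↭-sym A↭) (there x∈A′)) ⟩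
    count (_<ᵇ x) N                              ∎
    where open ≤-Reasoning
  ... | no b≰x = begin
    suc (blocks (inSx x) A′ + count (inSx x) A′)
      ≤⟨ s≤s (+-monoˡ-≤ _ (blocks-⊆ (inSx-mono (<⇒≤ x<b)) A′)) ⟩
    suc (blocks (inSx b) A′ + count (inSx b ∖ᵇ inSx x) A′ + count (inSx x) A′)
      ≡⟨ cong suc (trans (rearrange (blocks (inSx b) A′) _ _)
                         (cong (blocks (inSx b) A′ +_) (sym (count-⊆ (inSx-mono (<⇒≤ x<b)) A′)))) ⟩
    suc (blocks (inSx b) A′ + count (inSx b) A′) ≤⟨ demand-drop ⟩
    blocks (inSx b) A + count (inSx b) A         ≤⟨ supply b b∈A ⟩
    count (_<ᵇ b) N                              ≡⟨ sym (count-largestBelow largestBelow-neighbour v<x (<⇒≤ x<b)) ⟩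
    count (_<ᵇ x) N                              ∎
    where
    open ≤-Reasoning
    x<b : x < b
    x<b = ≰⇒> b≰x
    rearrange : ∀ X q c → X + q + c ≡ X + (c + q)
    rearrange = solve-∀

  supply-delete : Supply A′ rest
  supply-delete x x∈A′ with x<M ← All.lookup A′<M x∈A′ | value <? x
  ... | yes v<x = s≤s⁻¹ (begin
    suc (blocks (inSx x) A′ + count (inSx x) A′) ≤⟨ supply-strict x x∈A′ v<x ⟩
    count (_<ᵇ x) N                              ≡⟨ count-N x ⟩
    indicator (value <ᵇ x) + count (_<ᵇ x) rest  ≡⟨ cong (λ c → indicator c + count (_<ᵇ x) rest) (≤⇒≤ᵇ≡true v<x) ⟩
    suc (count (_<ᵇ x) rest)                     ∎)
    where open ≤-Reasoning
  ... | no v≮x = begin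
    blocks (inSx x) A′ + count (inSx x) A′       ≤⟨ +-mono-≤ (blocks≤ x x<M) (≤-reflexive (sym (count-delete x x<M))) ⟩
    blocks (inSx x) A + count (inSx x) A         ≤⟨ supply x (∈-resp-↭ (↭-sym A↭) (there x∈A′)) ⟩
    count (_<ᵇ x) N                              ≡⟨ count-N x ⟩
    indicator (value <ᵇ x) + count (_<ᵇ x) rest  ≡⟨ cong (λ c → indicator c + count (_<ᵇ x) rest) (>⇒≤ᵇ≡false (s≤s (≮⇒≥ v≮x))) ⟩
    count (_<ᵇ x) rest                           ∎
    where open ≤-Reasoning

  bound-delete : suc (length A′) ≤ count (_<ᵇ M) rest
  bound-delete = s≤s⁻¹ (begin
    suc (suc (length A′))                  ≡⟨ cong suc (sym (↭-length A↭)) ⟩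
    suc (length A)                         ≤⟨ +-monoˡ-≤ (length A) (blocks-pos (inSx M) A M∈A (≤⇒≤ᵇ≡true (≤-refl {M}))) ⟩
    blocks (inSx M) A + length A           ≡⟨ cong (blocks (inSx M) A +_) (sym (count-all A A≤M)) ⟩
    blocks (inSx M) A + count (inSx M) A   ≤⟨ supply M M∈A ⟩
    count (_<ᵇ M) N                        ≡⟨ count-N M ⟩
    indicator (value <ᵇ M) + count (_<ᵇ M) rest ≡⟨ cong (λ c → indicator c + count (_<ᵇ M) rest) (≤⇒≤ᵇ≡true (<-≤-trans value<b b≤M)) ⟩
    suc (count (_<ᵇ M) rest)               ∎)
    where
    open ≤-Reasoning
    A≤M : All (λ y → inSx M y ≡ true) A
    A≤M = All-resp-↭ (↭-sym A↭) (≤⇒≤ᵇ≡true (≤-refl {M}) ∷ All.map (λ y<M → ≤⇒≤ᵇ≡true (<⇒≤ y<M)) A′<M)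

record Extension (A : List ℕ) (v : ℕ) (ps : List (ℕ × ℕ)) (f : ℕ) : Set where
  field
    steps : List (ℕ × ℕ)
    final : ℕ
    isZigzag : IsZigzag steps final
    peaks≡ : peaks steps ≡ A
    valleys↭ : valleys steps final ↭ v ∷ valleys ps f

Extensible : List ℕ → ℕ → List ℕ → ℕ → Set
Extensible A M A′ b = ∀ {ps f v} → IsZigzag ps f → peaks ps ≡ A′ → All (_< M) (valleys ps f) →
  v < b → v < M → Extension A v ps f

extensible-front : ∀ M A′ → Extensible (M ∷ A′) M A′ M
extensible-front M A′ {ps} {f} {v} zz eq vs<M _ v<M = record
  { steps = (v , M) ∷ ps ; final = f
  ; isZigzag = v<M , All.lookup vs<M (firstValley∈valleys ps f) , zz
  ; peaks≡ = cong (M ∷_) eq ; valleys↭ = ↭-refl }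

extensible-back : ∀ A′ M → Extensible (A′ ++ [ M ]) M A′ M
extensible-back A′ M {ps} {f} {v} zz eq vs<M _ v<M = record
  { steps = ps ++ [ (f , M) ] ; final = v
  ; isZigzag = isZigzag-++⁺ ps [ (f , M) ] v zz (All.lookup vs<M (final∈valleys ps f) , v<M , tt)
  ; peaks≡ = trans (map-++ proj₂ ps [ (f , M) ]) (cong (_++ [ M ]) eq)
  ; valleys↭ = valleys-snoc-↭ ps f M v }

extensible-middle : ∀ L l M r R → Extensible (L ++ l ∷ M ∷ r ∷ R) M (L ++ l ∷ r ∷ R) (l ⊔ r)
extensible-middle L l M r R {ps} {f} {v} zz eq vs<M v<b v<M
  with psL , _ , refl , eqL , eq′ ← peaks-++⁻ ps L (l ∷ r ∷ R) eq
  with u₁ , _ , refl , eq″ ← peaks-∷⁻ _ l (r ∷ R) eq′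
  with u₂ , psR , refl , eqR ← peaks-∷⁻ _ r R eq″
  with zzL , (u₁<l , u₂<l , u₂<r , w<r , zzR) ← isZigzag-++⁻ psL ((u₁ , l) ∷ (u₂ , r) ∷ psR) f zz
  with _ ∷ u₂<M ∷ _ ← All.++⁻ʳ (map proj₁ psL) (subst (All (_< M)) (valleys-++ psL _ f) vs<M)
  with l ≤? r
... | yes l≤r = record
  { steps = psL ++ (u₁ , l) ∷ (u₂ , M) ∷ (v , r) ∷ psR ; final = f
  ; isZigzag = isZigzag-++⁺ psL _ f zzL (u₁<l , u₂<l , u₂<M , v<M , v<r , w<r , zzR)
  ; peaks≡ = trans (map-++ proj₂ psL _) (cong₂ (λ X Y → X ++ l ∷ M ∷ r ∷ Y) eqL eqR)
  ; valleys↭ = valleys-++-↭ psL _ _ f (λ _ → ↭-trans (prep u₁ (swap u₂ v ↭-refl)) (swap u₁ v ↭-refl)) }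
  where
  v<r : v < r
  v<r = subst (v <_) (m≤n⇒m⊔n≡n l≤r) v<b
... | no l≰r = record
  { steps = psL ++ (u₁ , l) ∷ (v , M) ∷ (u₂ , r) ∷ psR ; final = f
  ; isZigzag = isZigzag-++⁺ psL _ f zzL (u₁<l , v<l , v<M , u₂<M , u₂<r , w<r , zzR)
  ; peaks≡ = trans (map-++ proj₂ psL _) (cong₂ (λ X Y → X ++ l ∷ M ∷ r ∷ Y) eqL eqR)
  ; valleys↭ = valleys-++-↭ psL _ _ f (λ _ → swap u₁ v ↭-refl) }
  where
  v<l : v < l
  v<l = subst (v <_) (m≥n⇒m⊔n≡m (<⇒≤ (≰⇒> l≰r))) v<b

demand-drop-max : ∀ {A M A′} → A ↭ M ∷ A′ → All (_< M) A′ →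
  suc (blocks (inSx M) A′ + count (inSx M) A′) ≤ blocks (inSx M) A + count (inSx M) A
demand-drop-max {A} {M} {A′} A↭ A′<M = begin
  suc (blocks (inSx M) A′ + count (inSx M) A′) ≤⟨ s≤s (+-monoˡ-≤ _ blocks-A′≤1) ⟩
  suc (1 + count (inSx M) A′)                  ≤⟨ +-monoˡ-≤ _ (blocks-pos (inSx M) A (∈-resp-↭ (↭-sym A↭) (here refl)) M≤M) ⟩
  blocks (inSx M) A + suc (count (inSx M) A′)  ≡⟨ cong (blocks (inSx M) A +_) (sym count-A) ⟩
  blocks (inSx M) A + count (inSx M) A         ∎
  where
  open ≤-Reasoning
  M≤M : inSx M M ≡ true
  M≤M = ≤⇒≤ᵇ≡true (≤-refl {M})
  blocks-A′≤1 : blocks (inSx M) A′ ≤ 1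
  blocks-A′≤1 = ≤-trans (blocksAux≤count-not (inSx M) false A′)
    (≤-reflexive (cong suc (count-none A′ (All.map (λ y<M → cong not (≤⇒≤ᵇ≡true (<⇒≤ y<M))) A′<M))))
  count-A : count (inSx M) A ≡ suc (count (inSx M) A′)
  count-A rewrite count-↭ (inSx M) A↭ | M≤M = refl

maxDeletion-end : ∀ L M R → All (_< M) (L ++ R) → MaxDeletion (L ++ M ∷ R) M (L ++ R) M
maxDeletion-end L M R A′<M = record
  { A↭ = A↭
  ; A′<M = A′<M
  ; b∈A = ∈-++⁺ʳ L (here refl)
  ; b≤M = ≤-refl
  ; blocks≤ = λ x x<M → blocks-delete (inSx x) false L M R (>⇒≤ᵇ≡false x<M)
  ; blocks-merged = λ x M≤x x<M → contradiction x<M (≤⇒≯ M≤x)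
  ; demand-drop = demand-drop-max A↭ A′<M }
  where
  A↭ : L ++ M ∷ R ↭ M ∷ L ++ R
  A↭ = shift M L R

maxDeletion-middle : ∀ L l M r R → All (_< M) (L ++ l ∷ r ∷ R) →
  MaxDeletion (L ++ l ∷ M ∷ r ∷ R) M (L ++ l ∷ r ∷ R) (l ⊔ r)
maxDeletion-middle L l M r R A′<M = record
  { A↭ = A↭
  ; A′<M = A′<M
  ; b∈A = neighbour∈
  ; b≤M = b≤M
  ; blocks≤ = blocks≤
  ; blocks-merged = blocks-merged
  ; demand-drop = ≤-reflexive (cong₂ _+_ (blocks-merged b ≤-refl b<M) (sym count-A))
  }
  where
  A↭ : L ++ l ∷ M ∷ r ∷ R ↭ M ∷ L ++ l ∷ r ∷ R
  A↭ = ↭-trans (++⁺ˡ L (swap l M ↭-refl)) (shift M L (l ∷ r ∷ R))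
  b = l ⊔ r
  l<M : l < M
  l<M = All.lookup A′<M (∈-++⁺ʳ L (here refl))
  r<M : r < M
  r<M = All.lookup A′<M (∈-++⁺ʳ L (there (here refl)))
  b<M : b < M
  b<M = ⊔-lub l<M r<M
  b≤M : b ≤ M
  b≤M = <⇒≤ b<M
  neighbour∈ : b ∈ L ++ l ∷ M ∷ r ∷ R
  neighbour∈ with ⊔-sel l r
  ... | inj₁ b≡l rewrite b≡l = ∈-++⁺ʳ L (here refl)
  ... | inj₂ b≡r rewrite b≡r = ∈-++⁺ʳ L (there (there (here refl)))
  blocks≤ : ∀ x → x < M → blocks (inSx x) (L ++ l ∷ r ∷ R) ≤ blocks (inSx x) (L ++ l ∷ M ∷ r ∷ R)
  blocks≤ x x<M rewrite sym (++-assoc L [ l ] (r ∷ R)) | sym (++-assoc L [ l ] (M ∷ r ∷ R)) =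
    blocks-delete (inSx x) false (L ++ [ l ]) M (r ∷ R) (>⇒≤ᵇ≡false x<M)
  blocks-merged : ∀ x → b ≤ x → x < M → suc (blocks (inSx x) (L ++ l ∷ r ∷ R)) ≡ blocks (inSx x) (L ++ l ∷ M ∷ r ∷ R)
  blocks-merged x b≤x x<M = sym (blocks-merge (inSx x) false L l M r R
    (≤⇒≤ᵇ≡true (≤-trans (m≤m⊔n l r) b≤x)) (>⇒≤ᵇ≡false x<M) (≤⇒≤ᵇ≡true (≤-trans (m≤n⊔m l r) b≤x)))
  count-A : count (inSx b) (L ++ l ∷ M ∷ r ∷ R) ≡ count (inSx b) (L ++ l ∷ r ∷ R)
  count-A rewrite count-↭ (inSx b) A↭ | >⇒≤ᵇ≡false b<M = refl

record Peeling (A : List ℕ) : Set where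
  field
    M b : ℕ
    A′ : List ℕ
    deletion : MaxDeletion A M A′ b
    extensible : Extensible A M A′ b

peeling-at : ∀ L M R → All (_< M) (L ++ R) → Peeling (L ++ M ∷ R)
peeling-at L M [] A′<M = record
  { deletion = subst (λ A′ → MaxDeletion (L ++ [ M ]) M A′ M) (++-identityʳ L) (maxDeletion-end L M [] A′<M)
  ; extensible = extensible-back L M }
peeling-at L M (r ∷ R) A′<M with initLast L
... | [] = record { deletion = maxDeletion-end [] M (r ∷ R) A′<M ; extensible = extensible-front M (r ∷ R) }
... | L₀ ∷ʳ′ l = subst Peeling (sym (++-assoc L₀ [ l ] (M ∷ r ∷ R))) record
  { deletion = maxDeletion-middle L₀ l M r R (subst (All (_< M)) (++-assoc L₀ [ l ] (r ∷ R)) A′<M)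
  ; extensible = extensible-middle L₀ l M r R }

peeling-max : ∀ {A M} → M ∈ A → All (_≤ M) A → Unique A → Peeling A
peeling-max {M = M} M∈A A≤M uniq with L , R , refl ← ∈-∃++ M∈A = peeling-at L M R others<M
  where
  others<M : All (_< M) (L ++ R)
  others<M with _ ∷ others≤M ← All-resp-↭ (shift M L R) A≤M
              | M≢others ∷ _ ← unique-↭ (shift M L R) uniq =
    All.tabulate λ y∈ → ≤∧≢⇒< (All.lookup others≤M y∈) (λ y≡M → All.lookup M≢others y∈ (sym y≡M))

peeling : ∀ A → Unique A → A ≡ [] ⊎ Peeling A
peeling [] _ = inj₁ refl
peeling (a ∷ as) uniq = inj₂ (peeling-max max∈ (⊥≤max a as ∷ xs≤max a as) uniq)
  where
  max∈ : max a as ∈ a ∷ as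
  max∈ with argmax-sel id a as
  ... | inj₁ max≡a = subst (_∈ a ∷ as) (sym max≡a) (here refl)
  ... | inj₂ max∈as = there max∈as

realisation-[] : ∀ N B → 1 ≤ count (_<ᵇ B) N → Realisation [] N B
realisation-[] N B pos = record
  { steps = [] ; final = value ; unused = rest ; isZigzag = tt ; peaks≡ = refl
  ; valleys↭ = ↭-sym N↭ ; valleys<B = value<b ∷ [] }
  where open LargestBelow (largestBelow B N pos)

extend : ∀ {A A′ N N′ M B v} (ρ : Realisation A′ N′ M) →
  Extension A v (Realisation.steps ρ) (Realisation.final ρ) → v < M → M ≤ B → N ↭ v ∷ N′ → Realisation A N B
extend {A} {N = N} {N′} {M} {B} {v} ρ ext v<M M≤B N↭ = record
  { steps = E.steps ; final = E.final ; unused = ρ.unused ; isZigzag = E.isZigzag ; peaks≡ = E.peaks≡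
  ; valleys↭ = begin
      valleys E.steps E.final ++ ρ.unused            ↭⟨ ++⁺ʳ ρ.unused E.valleys↭ ⟩
      v ∷ valleys ρ.steps ρ.final ++ ρ.unused        ↭⟨ prep v ρ.valleys↭ ⟩
      v ∷ N′                                         ↭⟨ ↭-sym N↭ ⟩
      N                                              ∎
  ; valleys<B = All-resp-↭ (↭-sym E.valleys↭) (<-≤-trans v<M M≤B ∷ All.map (λ u<M → <-≤-trans u<M M≤B) ρ.valleys<B) }
  where
  module ρ = Realisation ρ
  module E = Extension ext
  open ↭.PermutationReasoning

realise : ∀ k A N B → length A ≡ k → Unique A → All (_≤ B) A → suc (length A) ≤ count (_<ᵇ B) N →
  Supply A N → Realisation A N B
realise k A N B len uniq A≤B pos supply with peeling A uniq
... | inj₁ refl = realisation-[] N B pos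
realise zero A N B len uniq A≤B pos supply | inj₂ P =
  contradiction (trans (sym len) (↭-length (MaxDeletion.A↭ (Peeling.deletion P)))) λ ()
realise (suc k) A N B len uniq A≤B pos supply | inj₂ P =
  extend ρ′ (extensible (isZigzag ρ′) (peaks≡ ρ′) (valleys<B ρ′) value<b v<M) v<M (All.lookup A≤B M∈A) N↭
  where
  open Peeling P
  open MaxDeletion deletion
  open LargestBelow (largestBelow-neighbour {N = N} deletion supply)
  open Realisation
  v<M : value < M
  v<M = <-≤-trans value<b b≤M
  ρ′ : Realisation A′ rest M
  ρ′ = realise k A′ rest M (suc-injective (trans (sym (↭-length A↭)) len)) (unique-delete uniq)
         (All.map <⇒≤ A′<M) (bound-delete {N = N} deletion supply) (supply-delete {N = N} deletion supply)

-- Propagation along the indices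

-- Indices are 0-based: j stands for the index i = j+1 of the statement.
module Propagation
  (p : ℕ) (x k : ℕ → ℕ)
  (x-lower : ∀ j → j < p → suc (suc j + suc j) ≤ x j)
  (k≤index : ∀ j → j < p → k j ≤ suc j)
  (k≤coindex : ∀ j → j < p → k j ≤ suc (p ∸ suc j))
  (k-step⁺ : ∀ j → suc j < p → k (suc j) ≤ suc (k j))
  (k-step⁻ : ∀ j → suc j < p → k j ≤ suc (k (suc j)))
  (special : ∀ j → 1 ≤ j → suc j < p → x j < (p + suc j + 1) ⊓ (3 * suc j) →
    x j ≤ x (j ∸ 1) + 2 → x j + 2 ≤ x (suc j) → k j + suc j + suc j ≤ x j)
  where

  Holds : ℕ → Set
  Holds j = k j + suc j + suc j ≤ x j

  holds-small : ∀ j → j < p → k j ≤ 1 → Holds j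
  holds-small j j<p k≤1 = ≤-trans (+-monoˡ-≤ (suc j) (+-monoˡ-≤ (suc j) k≤1)) (x-lower j j<p)

  holds-large : ∀ j → j < p → (p + suc j + 1) ⊓ (3 * suc j) ≤ x j → Holds j
  holds-large j j<p large with ⊓-sel (p + suc j + 1) (3 * suc j)
  ... | inj₁ ⊓≡ = begin
    k j + suc j + suc j               ≤⟨ +-monoˡ-≤ (suc j) (+-monoˡ-≤ (suc j) (k≤coindex j j<p)) ⟩
    suc (p ∸ suc j) + suc j + suc j   ≡⟨ cong (λ n → suc n + suc j) (m∸n+n≡m j<p) ⟩
    suc p + suc j                     ≡⟨ +-comm (p + suc j) 1 ⟨
    p + suc j + 1                     ≡⟨ ⊓≡ ⟨
    (p + suc j + 1) ⊓ (3 * suc j)     ≤⟨ large ⟩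
    x j                               ∎
    where open ≤-Reasoning
  ... | inj₂ ⊓≡ = begin
    k j + suc j + suc j               ≤⟨ +-monoˡ-≤ (suc j) (+-monoˡ-≤ (suc j) (k≤index j j<p)) ⟩
    suc j + suc j + suc j             ≡⟨ thrice (suc j) ⟩
    3 * suc j                         ≡⟨ ⊓≡ ⟨
    (p + suc j + 1) ⊓ (3 * suc j)     ≤⟨ large ⟩
    x j                               ∎
    where
    open ≤-Reasoning
    thrice : ∀ i → i + i + i ≡ 3 * i
    thrice = solve-∀

  holds-rightward : ∀ d j → suc j + d ≡ p → x j ≤ x (j ∸ 1) + 2 → Holds j
  holds-rightward zero j j+1≡p _ = holds-small j j<p (begin
    k j                   ≤⟨ subst (λ q → k j ≤ suc (q ∸ suc j)) p≡j+1 (k≤coindex j j<p) ⟩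
    suc (j ∸ j)           ≡⟨ cong suc (n∸n≡0 j) ⟩
    1                     ∎)
    where
    open ≤-Reasoning
    p≡j+1 : p ≡ suc j
    p≡j+1 = trans (sym j+1≡p) (+-identityʳ (suc j))
    j<p : j < p
    j<p = ≤-reflexive (sym p≡j+1)
  holds-rightward (suc d) zero 1+d≡p _ = holds-small 0 0<p (k≤index 0 0<p)
    where
    0<p : 0 < p
    0<p = subst (0 <_) 1+d≡p (s≤s z≤n)
  holds-rightward (suc d) (suc j) j+2+d≡p close =
    by-cases (x (suc j) <? (p + suc (suc j) + 1) ⊓ (3 * suc (suc j))) (x (suc j) + 2 ≤? x (suc (suc j)))
    where
    j+1<p : suc j < p
    j+1<p = subst (suc (suc j) ≤_) j+2+d≡p (m≤m+n (suc (suc j)) (suc d))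
    j+3+d≡p : suc (suc (suc j)) + d ≡ p
    j+3+d≡p = trans (sym (+-suc (suc (suc j)) d)) j+2+d≡p
    j+2<p : suc (suc j) < p
    j+2<p = subst (suc (suc (suc j)) ≤_) j+3+d≡p (m≤m+n _ d)
    by-cases : Dec (x (suc j) < (p + suc (suc j) + 1) ⊓ (3 * suc (suc j))) →
      Dec (x (suc j) + 2 ≤ x (suc (suc j))) → Holds (suc j)
    by-cases (no ¬small) _ = holds-large (suc j) j+1<p (≮⇒≥ ¬small)
    by-cases (yes small) (yes gap) = special (suc j) (s≤s z≤n) j+2<p small close gap
    by-cases (yes _) (no ¬gap) = s≤s⁻¹ (begin
      suc (k (suc j) + suc (suc j) + suc (suc j))  ≤⟨ s≤s (+-monoˡ-≤ _ (+-monoˡ-≤ _ (k-step⁻ (suc j) j+2<p))) ⟩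
      suc (suc (k (suc (suc j))) + suc (suc j) + suc (suc j)) ≡⟨ rearrange (k (suc (suc j))) j ⟩
      k (suc (suc j)) + suc (suc (suc j)) + suc (suc (suc j)) ≤⟨ next ⟩
      x (suc (suc j))                               ≤⟨ next-close ⟩
      suc (x (suc j))                               ∎)
      where
      open ≤-Reasoning
      next-close : x (suc (suc j)) ≤ suc (x (suc j))
      next-close = s≤s⁻¹ (≤-trans (≰⇒> ¬gap) (≤-reflexive (+-comm (x (suc j)) 2)))
      next : Holds (suc (suc j))
      next = holds-rightward d (suc (suc j)) j+3+d≡p
        (≤-trans next-close (≤-trans (n≤1+n _) (≤-reflexive (+-comm 2 (x (suc j))))))
      rearrange : ∀ b i → suc (suc b + suc (suc i) + suc (suc i)) ≡ b + suc (suc (suc i)) + suc (suc (suc i))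
      rearrange = solve-∀

  holds : ∀ j → j < p → Holds j
  holds zero 0<p = holds-small 0 0<p (k≤index 0 0<p)
  holds (suc j) j+1<p with x (suc j) ≤? x j + 2
  ... | yes close = holds-rightward (p ∸ suc (suc j)) (suc j) (m+[n∸m]≡n j+1<p) close
  ... | no ¬close = begin
    k (suc j) + suc (suc j) + suc (suc j)  ≤⟨ +-monoˡ-≤ _ (+-monoˡ-≤ _ (k-step⁺ j j+1<p)) ⟩
    suc (k j) + suc (suc j) + suc (suc j)  ≡⟨ rearrange (k j) j ⟩
    k j + suc j + suc j + 3                ≤⟨ +-monoˡ-≤ 3 (holds j (<-trans (n<1+n j) j+1<p)) ⟩
    x j + 3                                ≡⟨ +-suc (x j) 2 ⟩
    suc (x j + 2)                          ≤⟨ ≰⇒> ¬close ⟩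
    x (suc j)                              ∎
    where
    open ≤-Reasoning
    rearrange : ∀ b i → suc b + suc (suc i) + suc (suc i) ≡ b + suc i + suc i + 3
    rearrange = solve-∀

i-k+k≡i : ∀ i k → i ℤ.- k ℤ.+ k ≡ i
i-k+k≡i = ℤ-Solver.solve-∀

i+k-k≡i : ∀ i k → i ℤ.+ k ℤ.- k ≡ i
i+k-k≡i = ℤ-Solver.solve-∀

i-k≤j-k⇒i≤j : ∀ {i j} k → i ℤ.- k ℤ.≤ j ℤ.- k → i ℤ.≤ j
i-k≤j-k⇒i≤j {i} {j} k h = subst₂ ℤ._≤_ (i-k+k≡i i k) (i-k+k≡i j k) (ℤ.+-monoˡ-≤ k h)

interruption-bound⇔ : ∀ b c d → ℤ.+ b ℤ.- ℤ.+ 1 ℤ.≤ (ℤ.+ d ℤ.- ℤ.+ c) ℤ.- ℤ.+ 1 ⇔ b + c ≤ d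
interruption-bound⇔ b c d = mk⇔ to from
  where
  to : ℤ.+ b ℤ.- ℤ.+ 1 ℤ.≤ (ℤ.+ d ℤ.- ℤ.+ c) ℤ.- ℤ.+ 1 → b + c ≤ d
  to h = ℤ.drop‿+≤+ (subst (ℤ._≤ ℤ.+ d) (sym (ℤ.pos-+ b c))
           (i-k≤j-k⇒i≤j (ℤ.+ c) (subst (ℤ._≤ ℤ.+ d ℤ.- ℤ.+ c) (sym (i+k-k≡i (ℤ.+ b) (ℤ.+ c)))
             (i-k≤j-k⇒i≤j (ℤ.+ 1) h))))
  from : b + c ≤ d → ℤ.+ b ℤ.- ℤ.+ 1 ℤ.≤ (ℤ.+ d ℤ.- ℤ.+ c) ℤ.- ℤ.+ 1
  from h = ℤ.+-monoˡ-≤ (ℤ.- ℤ.+ 1) (subst (ℤ._≤ ℤ.+ d ℤ.- ℤ.+ c) (i+k-k≡i (ℤ.+ b) (ℤ.+ c))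
             (ℤ.+-monoˡ-≤ (ℤ.- ℤ.+ c) (subst (ℤ._≤ ℤ.+ d) (ℤ.pos-+ b c) (+≤+ h))))

demand≤⇒supply≤ : ∀ b j c x → j + c ≡ x ∸ 1 → b + suc j + suc j ≤ x → b + suc j ≤ c
demand≤⇒supply≤ b j c x j+c≡x-1 h = +-cancelʳ-≤ j (b + suc j) c (s≤s⁻¹ (begin
  suc (b + suc j + j)  ≡⟨ +-suc (b + suc j) j ⟨
  b + suc j + suc j    ≤⟨ h ⟩
  x                    ≡⟨ m∸n+n≡m x≥1 ⟨
  x ∸ 1 + 1            ≡⟨ cong (_+ 1) (sym j+c≡x-1) ⟩
  j + c + 1            ≡⟨ +-comm (j + c) 1 ⟩
  suc (j + c)          ≡⟨ cong suc (+-comm j c) ⟩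
  suc (c + j)          ∎))
  where
  open ≤-Reasoning
  x≥1 : 1 ≤ x
  x≥1 = ≤-trans (s≤s z≤n) (≤-trans (m≤n+m (suc j) (b + suc j)) h)

module Orderings (S : List ℕ) (sorted : AllPairs _<_ S) (n₀ : ℕ) (w₀ : List ℕ) (w₀↭ : IsPerm n₀ w₀)
                 (w₀-pinnacles : pinnacles w₀ ↭ S) (𝒜 : List ℕ) (𝒜↭S : 𝒜 ↭ S) where

  S-bounds : ∀ {z} → z ∈ S → 1 ≤ z × z ≤ n₀
  S-bounds z∈S = ∈-interval⁻ (∈-resp-↭ w₀↭ (pinnacles⊆ w₀ (∈-resp-↭ (↭-sym w₀-pinnacles) z∈S)))

  cardSx≡count-𝒜 : ∀ x → cardSx S x ≡ count (inSx x) 𝒜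
  cardSx≡count-𝒜 x = trans (cardSx≡count x sorted (All.tabulate (proj₁ ∘ S-bounds))) (sym (count-↭ (inSx x) 𝒜↭S))

  interruptions⇔demand : ∀ x → interruptions x 𝒜 ℤ.≤ kx S x ⇔ demand x false 𝒜 ≤ x
  interruptions⇔demand x = mk⇔
    (λ h → subst₂ _≤_ (sym demand≡) (cardSx+cardSbarx S x) (+-monoʳ-≤ c (Equivalence.to bound⇔ h)))
    (λ h → Equivalence.from bound⇔ (+-cancelˡ-≤ c _ _ (subst₂ _≤_ demand≡ (sym (cardSx+cardSbarx S x)) h)))
    where
    c = cardSx S x
    b = blocks (inSx x) 𝒜
    bound⇔ = interruption-bound⇔ b c (cardSbarx S x)
    demand≡ : demand x false 𝒜 ≡ c + (b + c)
    demand≡ = begin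
      count (inSx x) 𝒜 + count (inSx x) 𝒜 + b ≡⟨ cong (λ c → c + c + b) (cardSx≡count-𝒜 x) ⟨
      c + c + b                                ≡⟨ +-assoc c c b ⟩
      c + (c + b)                              ≡⟨ cong (c +_) (+-comm c b) ⟩
      c + (b + c)                              ∎
      where open ≡-Reasoning

  necessary : AdmissibleOrdering 𝒜 → ∀ x → x ∈ S → demand x false 𝒜 ≤ x
  necessary (n , w , w↭ , pinnacles≡𝒜) x x∈S =
    subst (λ A → demand x false A ≤ x) pinnacles≡𝒜 (demand-permutation x w↭ x≤n)
    where
    x∈w : x ∈ w
    x∈w = pinnacles⊆ w (subst (x ∈_) (sym pinnacles≡𝒜) (∈-resp-↭ (↭-sym 𝒜↭S) x∈S))
    x≤n : x ≤ n
    x≤n = proj₂ (∈-interval⁻ (∈-resp-↭ w↭ x∈w))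

  p : ℕ
  p = length S

  xs : ℕ → ℕ
  xs = nth S

  ks : ℕ → ℕ
  ks j = blocks (inSx (xs j)) 𝒜

  count-𝒜-≤-nth : ∀ j → j < p → count (inSx (xs j)) 𝒜 ≡ suc j
  count-𝒜-≤-nth j j<p = trans (count-↭ _ 𝒜↭S) (count-≤-nth S j sorted j<p)

  demand-nth : ∀ j → j < p → demand (xs j) false 𝒜 ≡ ks j + suc j + suc j
  demand-nth j j<p rewrite count-𝒜-≤-nth j j<p = trans (+-comm (suc j + suc j) (ks j)) (sym (+-assoc (ks j) _ _))

  xs-lower : ∀ j → j < p → suc (suc j + suc j) ≤ xs j
  xs-lower j j<p = begin
    suc (suc j + suc j)                                  ≡⟨ +-comm 1 (suc j + suc j) ⟩
    suc j + suc j + 1                                    ≤⟨ +-mono-≤ (≤-reflexive (cong (λ c → c + c) (sym count≡))) blocks≥1 ⟩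
    demand (xs j) false (pinnacles w₀)                   ≤⟨ demand-permutation (xs j) w₀↭ (proj₂ (S-bounds xj∈S)) ⟩
    xs j                                                 ∎
    where
    open ≤-Reasoning
    xj∈S = nth∈ S j j<p
    count≡ : count (inSx (xs j)) (pinnacles w₀) ≡ suc j
    count≡ = trans (count-↭ _ w₀-pinnacles) (count-≤-nth S j sorted j<p)
    blocks≥1 : 1 ≤ blocks (inSx (xs j)) (pinnacles w₀)
    blocks≥1 = blocks-pos _ _ (∈-resp-↭ (↭-sym w₀-pinnacles) xj∈S) (≤⇒≤ᵇ≡true (≤-refl {xs j}))

  ks≤index : ∀ j → j < p → ks j ≤ suc j
  ks≤index j j<p = ≤-trans (blocksAux≤count _ false 𝒜) (≤-reflexive (count-𝒜-≤-nth j j<p))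

  ks≤coindex : ∀ j → j < p → ks j ≤ suc (p ∸ suc j)
  ks≤coindex j j<p = ≤-trans (blocksAux≤count-not _ false 𝒜) (s≤s (≤-reflexive (begin
    c̄                                  ≡⟨ m+n∸m≡n (suc j) c̄ ⟨
    suc j + c̄ ∸ suc j                  ≡⟨ cong (λ c → c + c̄ ∸ suc j) (count-𝒜-≤-nth j j<p) ⟨
    count (inSx (xs j)) 𝒜 + c̄ ∸ suc j  ≡⟨ cong (_∸ suc j) (count+count-not≡length _ 𝒜) ⟩
    length 𝒜 ∸ suc j                   ≡⟨ cong (_∸ suc j) (↭-length 𝒜↭S) ⟩
    p ∸ suc j                          ∎)))
    where
    open ≡-Reasoning
    c̄ = count (not ∘ inSx (xs j)) 𝒜

  xs-⊆ : ∀ j → suc j < p → inSx (xs j) ⊆ᵇ inSx (xs (suc j))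
  xs-⊆ j j+1<p = inSx-mono (<⇒≤ (nth-< S j sorted j+1<p))

  count-gap : ∀ j → suc j < p → count (inSx (xs (suc j)) ∖ᵇ inSx (xs j)) 𝒜 ≡ 1
  count-gap j j+1<p = +-cancelˡ-≡ (suc j) _ 1 (begin
    suc j + g                    ≡⟨ cong (_+ g) (count-𝒜-≤-nth j (<-trans (n<1+n j) j+1<p)) ⟨
    count (inSx (xs j)) 𝒜 + g    ≡⟨ count-⊆ (xs-⊆ j j+1<p) 𝒜 ⟨
    count (inSx (xs (suc j))) 𝒜  ≡⟨ count-𝒜-≤-nth (suc j) j+1<p ⟩
    suc (suc j)                  ≡⟨ +-comm 1 (suc j) ⟩
    suc j + 1                    ∎)
    where
    open ≡-Reasoning
    g = count (inSx (xs (suc j)) ∖ᵇ inSx (xs j)) 𝒜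

  ks-step⁺ : ∀ j → suc j < p → ks (suc j) ≤ suc (ks j)
  ks-step⁺ j j+1<p = ≤-trans (blocks-⊇ (xs-⊆ j j+1<p) 𝒜)
    (≤-reflexive (trans (cong (ks j +_) (count-gap j j+1<p)) (+-comm (ks j) 1)))

  ks-step⁻ : ∀ j → suc j < p → ks j ≤ suc (ks (suc j))
  ks-step⁻ j j+1<p = ≤-trans (blocks-⊆ (xs-⊆ j j+1<p) 𝒜)
    (≤-reflexive (trans (cong (ks (suc j) +_) (count-gap j j+1<p)) (+-comm (ks (suc j)) 1)))

  InterruptionCondition : Set
  InterruptionCondition = (i : ℕ) → 1 < i → i < length S →
    xAt S i < (length S + i + 1) ⊓ (3 * i) →
    xAt S i ≤ xAt S (i ∸ 1) + 2 →
    xAt S i + 2 ≤ xAt S (i + 1) →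
    interruptions (xAt S i) 𝒜 ℤ.≤ kx S (xAt S i)

  special : InterruptionCondition → ∀ j → 1 ≤ j → suc j < p → xs j < (p + suc j + 1) ⊓ (3 * suc j) →
    xs j ≤ xs (j ∸ 1) + 2 → xs j + 2 ≤ xs (suc j) → ks j + suc j + suc j ≤ xs j
  special H j 1≤j j+1<p small close gap = subst (_≤ xs j) (demand-nth j (<-trans (n<1+n j) j+1<p))
    (Equivalence.to (interruptions⇔demand (xs j))
      (H (suc j) (s≤s 1≤j) j+1<p small close (subst (λ i → xs j + 2 ≤ nth S i) (+-comm 1 j) gap)))

  N : List ℕ
  N = filter (λ y → ¬? (y ∈? S)) (interval n₀)

  S++N↭ : S ++ N ↭ interval n₀
  S++N↭ = ↭-sym (subst (λ T → interval n₀ ↭ T ++ N) filter≡S (filter-partition-↭ (_∈? S) (interval n₀)))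
    where
    filter≡S : filter (_∈? S) (interval n₀) ≡ S
    filter≡S = trans (filter-∈-interval n₀ sorted (All.tabulate (proj₁ ∘ S-bounds)))
                     (filter-all (_≤? n₀) (All.tabulate (proj₂ ∘ S-bounds)))

  count-S+N : ∀ P → count P S + count P N ≡ count P (interval n₀)
  count-S+N P = trans (sym (count-++ P S N)) (count-↭ P S++N↭)

  supply : (∀ j → j < p → ks j + suc j + suc j ≤ xs j) → Supply 𝒜 N
  supply holds x x∈𝒜 with j , j<p , refl ← ∈⇒nth S (∈-resp-↭ 𝒜↭S x∈𝒜) =
    subst (λ c → ks j + c ≤ count (_<ᵇ xs j) N) (sym (count-𝒜-≤-nth j j<p))
      (demand≤⇒supply≤ (ks j) j _ (xs j) count-below (holds j j<p))
    where
    count-below : j + count (_<ᵇ xs j) N ≡ xs j ∸ 1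
    count-below = trans (cong (_+ count (_<ᵇ xs j) N) (sym (count-<-nth S j sorted j<p)))
      (trans (count-S+N (_<ᵇ xs j)) (count-<-interval (xs j) n₀ (m≤n⇒m≤1+n (proj₂ (S-bounds (nth∈ S j j<p))))))

  valley-room : 1 ≤ p → suc (length 𝒜) ≤ count (_<ᵇ suc n₀) N
  valley-room p≥1 rewrite ↭-length 𝒜↭S = +-cancelˡ-≤ p (suc p) _ (begin
    p + suc p             ≡⟨ +-suc p p ⟩
    suc (p + p)           ≡⟨ cong (λ i → suc (i + i)) i+1≡p ⟨
    suc (suc i + suc i)   ≤⟨ xs-lower i i<p ⟩
    xs i                  ≤⟨ proj₂ (S-bounds (nth∈ S i i<p)) ⟩
    n₀                    ≡⟨ n₀≡ ⟩
    p + count (_<ᵇ suc n₀) N ∎)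
    where
    open ≤-Reasoning
    i = p ∸ 1
    i+1≡p : suc i ≡ p
    i+1≡p = trans (+-comm 1 i) (m∸n+n≡m p≥1)
    i<p : i < p
    i<p = ≤-reflexive i+1≡p
    count-S : count (_<ᵇ suc n₀) S ≡ p
    count-S = count-all S (All.tabulate λ z∈S → ≤⇒≤ᵇ≡true (s≤s (proj₂ (S-bounds z∈S))))
    n₀≡ : n₀ ≡ p + count (_<ᵇ suc n₀) N
    n₀≡ = sym (trans (cong (_+ count (_<ᵇ suc n₀) N) (sym count-S))
                     (trans (count-S+N (_<ᵇ suc n₀)) (count-<-interval (suc n₀) n₀ ≤-refl)))

  sufficient : InterruptionCondition → 1 ≤ p → AdmissibleOrdering 𝒜
  sufficient H p≥1 = n₀ , word , ↭-trans word-↭ (↭-trans (++⁺ʳ N 𝒜↭S) S++N↭) , pinnacles-word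
    where
    open Propagation p xs ks xs-lower ks≤index ks≤coindex ks-step⁺ ks-step⁻ (special H) using (holds)
    unique : Unique 𝒜
    unique = unique-↭ (↭-sym 𝒜↭S) (AllPairs.map <⇒≢ sorted)
    bounded : All (_≤ suc n₀) 𝒜
    bounded = All.tabulate λ x∈𝒜 → m≤n⇒m≤1+n (proj₂ (S-bounds (∈-resp-↭ 𝒜↭S x∈𝒜)))
    open Realisation (realise (length 𝒜) 𝒜 N (suc n₀) refl unique bounded (valley-room p≥1) (supply holds))

  admissible⇔ : AdmissibleOrdering 𝒜 ⇔ InterruptionCondition
  admissible⇔ = mk⇔
    (λ adm i _ i<p _ _ _ → Equivalence.from (interruptions⇔demand (xAt S i))
      (necessary adm (xAt S i) (nth∈ S (i ∸ 1) (≤-<-trans (m∸n≤m i 1) i<p))))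
    (λ H → by-length H p refl)
    where
    by-length : InterruptionCondition → ∀ q → p ≡ q → AdmissibleOrdering 𝒜
    by-length H zero p≡0 =
      subst AdmissibleOrdering (sym (length≡0⇒≡[] (trans (↭-length 𝒜↭S) p≡0))) (0 , [] , ↭-refl , refl)
    by-length H (suc _) p≡1+q = sufficient H (subst (1 ≤_) (sym p≡1+q) (s≤s z≤n))

corollary4p7 : (S : List ℕ) → AllPairs _<_ S → AdmissibleSet S →
    (𝒜 : List ℕ) → 𝒜 ↭ S →
    AdmissibleOrdering 𝒜 ⇔
      ((i : ℕ) → 1 < i → i < length S →
        xAt S i < (length S + i + 1) ⊓ (3 * i) →
        xAt S i ≤ xAt S (i ∸ 1) + 2 →
        xAt S i + 2 ≤ xAt S (i + 1) →
        interruptions (xAt S i) 𝒜 ℤ.≤ kx S (xAt S i))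
corollary4p7 S sorted (n₀ , w₀ , w₀↭ , w₀-pinnacles) 𝒜 𝒜↭S =
  Orderings.admissible⇔ S sorted n₀ w₀ w₀↭ w₀-pinnacles 𝒜 𝒜↭S
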